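{- Let $\mathcal{Q}$ be a quasiminimal pregeometry class and let $\langle M,\mathrm{cl}_M\rangle\in\mathcal{Q}$. Then for all $A\subseteq M$, $\mathrm{cl}_M(A)=\mathrm{cl}^M(A)$, where $\mathrm{cl}^M(A)$ is the intersection of all $H$ with $H\in\mathcal{Q}$, $A\subseteq H$ and $H\preccurlyeq M$.
   Context: Let $\mathfrak{L}$ be a language. A quasiminimal pregeometry class $\mathcal{Q}$ is a class of pairs $\langle H,\mathrm{cl}_H\rangle$, $H$ an $\mathfrak{L}$-structure and $\mathrm{cl}_H$ a pregeometry operator on $H$, such that: (1) (closure under isomorphisms) if $\langle H,\mathrm{cl}_H\rangle\in\mathcal{Q}$ and $f:H\to H'$ is an isomorphism of $\mathfrak{L}$-structures then $\langle H',\mathrm{cl}_{H'}\rangle\in\mathcal{Q}$ with $\mathrm{cl}_{H'}(X')=f(\mathrm{cl}_H(f^{ -1}(X')))$; (2) the empty function is a partial embedding between any two structures in $\mathcal{Q}$; (3) for each member, the closure of any finite set is countable; (4) (relativization) if $\langle H,\mathrm{cl}_H\rangle\in\mathcal{Q}$ and $X\subseteq H$ then $\langle\mathrm{cl}_H(X),\mathrm{cl}_H\restriction\mathrm{cl}_H(X)\rangle\in\mathcal{Q}$; (5) (closure coherence) if $\langle H,\mathrm{cl}_H\rangle,\langle H',\mathrm{cl}_{H'}\rangle\in\mathcal{Q}$, $X\subseteq H$, $y\in H$, and $f$ is a partial embedding $H\rightharpoonup H'$ defined on $X\cup\{y\}$, then $y\in\mathrm{cl}_H(X)$ iff $f(y)\in\mathrm{cl}_{H'}(f(X))$;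 (6) (homogeneity over countable models) if $C\subseteq H$, $C'\subseteq H'$ are countable closed sets (members $H,H'$ of $\mathcal{Q}$) and $g:C\to C'$ is an isomorphism, then (a) for $x\in H\setminus C$, $x'\in H'\setminus C'$, $g\cup\{(x,x')\}$ is a partial embedding, and (b) if $g\cup f$ is a partial embedding $H\rightharpoonup H'$ with $\mathrm{dom}(f)=X$ finite and $y\in\mathrm{cl}_H(X\cup C)$, then there is $y'\in H'$ such that $g\cup f\cup\{(y,y')\}$ is a partial embedding. For $G,H\in\mathcal{Q}$ with $G$ a substructure of $H$, write $G\preccurlyeq H$ when $G$ is closed in $H$ (i.e. $\mathrm{cl}_H(G)=G$). -}

module Defs where

open import Level using (0ℓ)
open import Data.Nat using (ℕ)
open import Data.Fin using (Fin)
open import Data.Vec using (Vec; []; _∷_; lookup; map)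
open import Data.Vec.Relation.Unary.All using (All; []; _∷_)
open import Data.Vec.Relation.Binary.Pointwise.Inductive using (Pointwise)
open import Data.List using (List)
import Data.List as List
open import Data.List.Membership.Propositional using () renaming (_∈_ to _∈L_)
open import Data.Product using (Σ; ∃; _×_; _,_; proj₁; proj₂)
open import Data.Sum using (_⊎_)
open import Relation.Nullary using (¬_)
import Data.Empty
open import Relation.Unary using (Pred; _⊆_; _∪_; _∈_)
open import Relation.Binary.PropositionalEquality using (_≡_)

_↔_ : ∀ {a b} → Set a → Set b → Set _
A ↔ B = (A → B) × (B → A)

record Signature : Set₁ where
  field
    Fun    : Set
    arity  : Fun → ℕ
    Rel    : Set
    rarity : Rel → ℕ
open Signature public

record Structure (L : Signature) : Set₁ where
  field
    Carrier : Set
    fun     : (f : Fun L) → Vec Carrier (arity L f) → Carrier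
    rel     : (r : Rel L) → Vec Carrier (rarity L r) → Set
open Structure public

module _ {L : Signature} where

  data Term (n : ℕ) : Set where
    var : Fin n → Term n
    app : (f : Fun L) → Vec (Term n) (arity L f) → Term n

  data Atomic (n : ℕ) : Set where
    eqA  : Term n → Term n → Atomic n
    relA : (r : Rel L) → Vec (Term n) (rarity L r) → Atomic n

  module _ (H : Structure L) where
    mutual
      eval : ∀ {n} → Term n → Vec (Carrier H) n → Carrier H
      eval (var i)    a = lookup a i
      eval (app f ts) a = fun H f (evalVec ts a)

      evalVec : ∀ {n k} → Vec (Term n) k → Vec (Carrier H) n → Vec (Carrier H) k
      evalVec []       a = []
      evalVec (t ∷ ts) a = eval t a ∷ evalVec ts a

    Sat : ∀ {n} → Atomic n → Vec (Carrier H) n → Set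
    Sat (eqA s t)   a = eval s a ≡ eval t a
    Sat (relA r ts) a = rel H r (evalVec ts a)

  -- Partial maps H ⇀ H' are represented by their graphs.
  -- A partial embedding is a partial map preserving (and reflecting)
  -- all atomic formulas, hence all quantifier-free formulas, on tuples
  -- from its domain (this forces it to be a function and injective).
  IsPartialEmbedding : (H H' : Structure L) → (Carrier H → Carrier H' → Set) → Set
  IsPartialEmbedding H H' R =
    ∀ n (a : Vec (Carrier H) n) (b : Vec (Carrier H') n) →
    Pointwise R a b → (φ : Atomic n) → Sat H φ a ↔ Sat H' φ b

  record Iso (H H' : Structure L) : Set where
    field
      to      : Carrier H → Carrier H'
      from    : Carrier H' → Carrier H
      from-to : ∀ x → from (to x) ≡ x
      to-from : ∀ y → to (from y) ≡ y
      to-fun  : ∀ f xs → to (fun H f xs) ≡ fun H' f (map to xs)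
      to-rel  : ∀ r xs → rel H r xs ↔ rel H' r (map to xs)

  IsSubstructure : (H : Structure L) → Pred (Carrier H) 0ℓ → Set
  IsSubstructure H P = ∀ f (xs : Vec (Carrier H) (arity L f)) → All P xs → P (fun H f xs)

  allProj : ∀ {H : Structure L} {P : Pred (Carrier H) 0ℓ} {k}
            (xs : Vec (Σ (Carrier H) P) k) → All P (map proj₁ xs)
  allProj []              = []
  allProj {H} {P} ((x , p) ∷ xs) = p ∷ allProj {H} {P} xs

  Induced : (H : Structure L) (P : Pred (Carrier H) 0ℓ) → IsSubstructure H P → Structure L
  Induced H P p = record
    { Carrier = Σ (Carrier H) P
    ; fun = λ f xs → fun H f (map proj₁ xs) , p f (map proj₁ xs) (allProj {H} {P} xs)
    ; rel = λ r xs → rel H r (map proj₁ xs)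
    }

ClOp : ∀ {L} → Structure L → Set₁
ClOp H = Pred (Carrier H) 0ℓ → Pred (Carrier H) 0ℓ

⟦_⟧ : {A : Set} → List A → Pred A 0ℓ
⟦ xs ⟧ = λ x → x ∈L xs

｛_｝ : {A : Set} → A → Pred A 0ℓ
｛ a ｝ = λ x → x ≡ a

record IsPregeometry {A : Set} (cl : Pred A 0ℓ → Pred A 0ℓ) : Set₁ where
  field
    extensive  : ∀ X → X ⊆ cl X
    monotone   : ∀ X Y → X ⊆ Y → cl X ⊆ cl Y
    idempotent : ∀ X → cl (cl X) ⊆ cl X
    finiteChar : ∀ X a → a ∈ cl X →
                 Σ (List A) λ xs → (⟦ xs ⟧ ⊆ X) × (a ∈ cl ⟦ xs ⟧)
    exchange   : ∀ X a b → a ∈ cl (X ∪ ｛ b ｝) → ¬ (a ∈ cl X) → b ∈ cl (X ∪ ｛ a ｝)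

Countable : {A : Set} → Pred A 0ℓ → Set
Countable {A} S = Σ (Σ A S → ℕ) λ c → ∀ x y → c x ≡ c y → proj₁ x ≡ proj₁ y

module _ {L : Signature} where

  transportCl : {H H' : Structure L} → Iso H H' → ClOp H → ClOp H'
  transportCl i cl X' y = Σ _ λ x → cl (λ z → X' (Iso.to i z)) x × Iso.to i x ≡ y

  restrictCl : {H : Structure L} (cl : ClOp H) (X : Pred (Carrier H) 0ℓ)
               (p : IsSubstructure H (cl X)) → ClOp (Induced H (cl X) p)
  restrictCl cl X p Y (h , _) = cl (λ h' → Σ (cl X h') λ q → Y (h' , q)) h

  image : {H H' : Structure L} → (Carrier H → Carrier H' → Set) →
          Pred (Carrier H) 0ℓ → Pred (Carrier H') 0ℓ
  image R X y = Σ _ λ x → X x × R x y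

Class : Signature → Set₂
Class L = (H : Structure L) → ClOp H → Set₁

record IsQPC (L : Signature) (Q : Class L) : Set₂ where
  field
    pregeometry : ∀ H cl → Q H cl → IsPregeometry cl
    isoClosed : ∀ H clH H' → Q H clH → (i : Iso H H') → Q H' (transportCl i clH)
    emptyPE : ∀ H clH H' clH' → Q H clH → Q H' clH' →
              IsPartialEmbedding H H' (λ _ _ → Data.Empty.⊥)
    countableCl : ∀ H clH → Q H clH → (xs : List (Carrier H)) → Countable (clH ⟦ xs ⟧)
    relativize : ∀ H clH → Q H clH → (X : Pred (Carrier H) 0ℓ) →
                 Σ (IsSubstructure H (clH X)) λ p →
                   Q (Induced H (clH X) p) (restrictCl {H = H} clH X p)
    coherence : ∀ H clH H' clH' → Q H clH → Q H' clH' →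
                (X : Pred (Carrier H) 0ℓ) (y : Carrier H)
                (R : Carrier H → Carrier H' → Set) → IsPartialEmbedding H H' R →
                (∀ x → x ∈ (X ∪ ｛ y ｝) → ∃ (R x)) →
                ∀ y' → R y y' → (y ∈ clH X) ↔ (y' ∈ clH' (image {H = H} {H' = H'} R X))
    homogeneity : ∀ H clH H' clH' → Q H clH → Q H' clH' →
                  (C : Pred (Carrier H) 0ℓ) (C' : Pred (Carrier H') 0ℓ) →
                  Countable C → Countable C' →
                  clH C ⊆ C → clH' C' ⊆ C' →
                  (g : Carrier H → Carrier H' → Set) →
                  IsPartialEmbedding H H' g →
                  (∀ x → C x ↔ ∃ (g x)) → (∀ y → C' y ↔ ∃ λ x → g x y) →
                  (∀ x x' → ¬ C x → ¬ C' x' →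
                     IsPartialEmbedding H H' (λ a b → g a b ⊎ (a ≡ x × b ≡ x')))
                  ×
                  (∀ (f : List (Carrier H × Carrier H')) →
                     IsPartialEmbedding H H' (λ a b → g a b ⊎ (a , b) ∈L f) →
                     ∀ y → y ∈ clH (⟦ List.map proj₁ f ⟧ ∪ C) →
                     Σ (Carrier H') λ y' →
                       IsPartialEmbedding H H'
                         (λ a b → g a b ⊎ ((a , b) ∈L f ⊎ (a ≡ y × b ≡ y'))))

clSup : ∀ {L} (Q : Class L) (M : Structure L) (clM : ClOp M) →
        Pred (Carrier M) 0ℓ → Carrier M → Set₁
clSup Q M clM A x =
  (P : Pred (Carrier M) 0ℓ) (p : IsSubstructure M P) (clP : ClOp (Induced M P p)) →
  Q (Induced M P p) clP → A ⊆ P → (clM P ⊆ P) × (P ⊆ clM P) → P x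

module Submission where

open import Defs
open import Level using (0ℓ)
open import Data.Product using (_×_; _,_; proj₁; proj₂)
open import Relation.Unary using (Pred; _⊆_)

module _ {A : Set} {cl : Pred A 0ℓ → Pred A 0ℓ} (pg : IsPregeometry cl) where
  open IsPregeometry pg

  cl-least-closed : ∀ {X P} → X ⊆ P → cl P ⊆ P → cl X ⊆ P
  cl-least-closed X⊆P clP⊆P x∈clX = clP⊆P (monotone _ _ X⊆P x∈clX)

  cl-closed : ∀ X → (cl (cl X) ⊆ cl X) × (cl X ⊆ cl (cl X))
  cl-closed X = idempotent X , extensive (cl X)

module _ {L : Signature} (Q : Class L) {M : Structure L} {clM : ClOp M} where

  cl⊆clSup : IsPregeometry clM → ∀ A → clM A ⊆ clSup Q M clM A
  cl⊆clSup pg A x∈clA P _ _ _ A⊆P (clP⊆P , _) = cl-least-closed pg A⊆P clP⊆P x∈clA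

  -- cl_M(A) is itself one of the structures being intersected, by relativization.
  clSup⊆cl : IsQPC L Q → Q M clM → ∀ A → clSup Q M clM A ⊆ clM A
  clSup⊆cl qpc qM A x∈clSupA =
    x∈clSupA (clM A) isSub (restrictCl {H = M} clM A isSub) relativized
             (IsPregeometry.extensive pg A) (cl-closed pg A)
    where
    open IsQPC qpc
    pg : IsPregeometry clM
    pg = pregeometry M clM qM
    isSub : IsSubstructure M (clM A)
    isSub = proj₁ (relativize M clM qM A)
    relativized : Q (Induced M (clM A) isSub) (restrictCl {H = M} clM A isSub)
    relativized = proj₂ (relativize M clM qM A)

lemma5p3 : (L : Signature) (Q : Class L) → IsQPC L Q →
           (M : Structure L) (clM : ClOp M) → Q M clM →
           (A : Pred (Carrier M) 0ℓ) →
           (∀ x → clM A x → clSup Q M clM A x) × (∀ x → clSup Q M clM A x → clM A x)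
lemma5p3 L Q qpc M clM qM A =
  (λ _ → cl⊆clSup Q (IsQPC.pregeometry qpc M clM qM) A) ,
  (λ _ → clSup⊆cl Q qpc qM A)
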